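{- Let $G$ be any graph and let $H$ be an induced subgraph of the independence graph $G^*$. Then $$\alpha^*(H|G)\le \Big(\min_{v\in\mathcal V(H)}N_v\Big)^{ -1}.$$ Moreover, if $H$ is an induced subgraph of $G^*$ that is also vertex-transitive, then $$\alpha^*(H|G)\le \frac{|\mathcal V(H)|}{\sum_{v\in\mathcal V(H)}N_v}.$$
   Context: All graphs are finite, simple, undirected; $\boxtimes$ is the strong product and $\alpha^*(A|B)=\sup_W \frac{\alpha(A\boxtimes W)}{\alpha(B\boxtimes W)}$ over all graphs $W$. $\mathcal I(G)$ is the set of independent sets of $G$ (including $\emptyset$); $\mathcal S,\mathcal T\in\mathcal I(G)$ are disconnected in $G$ if $\mathcal S\cap\mathcal T=\emptyset$ and $\mathcal S\cup\mathcal T\in\mathcal I(G)$. The independence graph $G^*$ has vertex set $\mathcal I(G)$, and distinct $\mathcal S,\mathcal T$ are adjacent iff they are not disconnected (i.e. $\mathcal S\cap\mathcal T\neq\emptyset$ or $\mathcal S\cup\mathcal T\notin\mathcal I(G)$). For a vertex $v$ of $G^*$, $N_v$ is the size of the independent set of $G$ corresponding to $v$. Convention $1/0=\infty$. -}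

module Defs where

open import Data.Nat using (ℕ; zero; suc; _+_; _*_; _⊔_; _⊓_)
open import Data.Bool using (Bool; true; false; not; _∧_; _∨_; if_then_else_)
open import Data.Fin using (Fin; remQuot; _≟_)
open import Data.Fin.Subset using (Subset; ∣_∣)
open import Data.Vec using (Vec; []; _∷_; lookup)
open import Data.List using (List; []; _∷_; map; _++_; foldr; allFin)
open import Data.Bool.ListAction using (and)
open import Data.Nat.ListAction using (sum)
open import Data.Product using (Σ; _×_; _,_; proj₁; proj₂)
open import Relation.Nullary using (does; ¬_)
open import Relation.Binary.PropositionalEquality using (_≡_)

record Graph (n : ℕ) : Set where
  field
    adj    : Fin n → Fin n → Bool
    sym    : ∀ i j → adj i j ≡ adj j i
    irrefl : ∀ i → adj i i ≡ false
open Graph public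

Rel : ℕ → Set
Rel n = Fin n → Fin n → Bool

_∈?_ : ∀ {n} → Fin n → Subset n → Bool
i ∈? s = lookup s i

indep? : ∀ {n} → Rel n → Subset n → Bool
indep? {n} r s =
  and (map (λ i → and (map (λ j →
    not ((i ∈? s) ∧ (j ∈? s) ∧ not (does (i ≟ j)) ∧ r i j)) (allFin n))) (allFin n))

allSubsets : ∀ n → List (Subset n)
allSubsets zero = [] ∷ []
allSubsets (suc n) = map (true ∷_) (allSubsets n) ++ map (false ∷_) (allSubsets n)

α : ∀ {n} → Rel n → ℕ
α {n} r = foldr _⊔_ 0 (map (λ s → if indep? r s then ∣ s ∣ else 0) (allSubsets n))

eqOrAdj : ∀ {n} → Rel n → Fin n → Fin n → Bool
eqOrAdj r a b = does (a ≟ b) ∨ r a b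

_⊠_ : ∀ {n m} → Rel n → Rel m → Rel (n * m)
_⊠_ {n} {m} r t p q =
  not (does (p ≟ q))
  ∧ eqOrAdj r (proj₁ (remQuot {n} m p)) (proj₁ (remQuot {n} m q))
  ∧ eqOrAdj t (proj₂ (remQuot {n} m p)) (proj₂ (remQuot {n} m q))

disjoint? : ∀ {n} → Subset n → Subset n → Bool
disjoint? {n} s t = and (map (λ i → not ((i ∈? s) ∧ (i ∈? t))) (allFin n))

union : ∀ {n} → Subset n → Subset n → Subset n
union [] [] = []
union (x ∷ s) (y ∷ t) = (x ∨ y) ∷ union s t

disconnected? : ∀ {n} → Graph n → Subset n → Subset n → Bool
disconnected? G s t = disjoint? s t ∧ indep? (adj G) (union s t)

-- H (on Fin k) is an induced subgraph of the independence graph G*: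
-- an injective labelling of H's vertices by independent sets of G such that
-- distinct vertices are adjacent in H iff their labels are not disconnected.
record InducedSubOfStar {n k : ℕ} (G : Graph n) (H : Graph k) : Set where
  field
    label       : Fin k → Subset n
    label-indep : ∀ i → indep? (adj G) (label i) ≡ true
    label-inj   : ∀ i j → label i ≡ label j → i ≡ j
    label-adj   : ∀ i j → ¬ (i ≡ j) →
                  adj H i j ≡ not (disconnected? G (label i) (label j))
open InducedSubOfStar public

N : ∀ {n k} {G : Graph n} {H : Graph k} → InducedSubOfStar G H → Fin k → ℕ
N ι v = ∣ label ι v ∣

minOver : ∀ k → (Fin k → ℕ) → ℕ
minOver zero f = 0
minOver (suc k) f = foldr _⊓_ (f Fin.zero) (map f (allFin (suc k)))
  where import Data.Fin as Fin

sumOver : ∀ k → (Fin k → ℕ) → ℕ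
sumOver k f = sum (map f (allFin k))

record Automorphism {k : ℕ} (H : Graph k) : Set where
  field
    σ       : Fin k → Fin k
    σ⁻¹     : Fin k → Fin k
    left    : ∀ i → σ⁻¹ (σ i) ≡ i
    right   : ∀ i → σ (σ⁻¹ i) ≡ i
    preserves : ∀ i j → adj H (σ i) (σ j) ≡ adj H i j
open Automorphism public

VertexTransitive : ∀ {k} → Graph k → Set
VertexTransitive {k} H = ∀ (u v : Fin k) → Σ (Automorphism H) (λ a → σ a u ≡ v)

-- An independent set I of H ⊠ W lifts to an independent set of G ⊠ W: replace each (h, w) ∈ I by
-- the points (g, w) with g in the independent set labelling h. Distinct members of I over equal or
-- adjacent W-vertices sit over H-vertices that are distinct and non-adjacent, whose labels are
-- therefore disconnected; so the lift is injective and independent, and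
-- ∑_{(h,w) ∈ I} N_h ≤ α(G ⊠ W). Bounding each N_h below by the minimum gives the first claim.
-- For vertex-transitive H, apply the same bound to the relabellings h ↦ label (x h) for every
-- automorphism x and add up: ∑_x N_{x h} does not depend on h, so it equals |Aut H| · (∑_v N_v) / k.
module Submission where

open import Defs hiding (sym)
open import Level using (Level)
open import Function using (_∘_; id)
open import Function.Bundles using (mk⇔)
open import Data.Empty using (⊥-elim) renaming (⊥ to Empty)
open import Data.Sum using (inj₁; inj₂)
open import Data.Product using (∃-syntax; _×_; _,_; proj₁; proj₂)
open import Data.Bool using (Bool; true; false; not; _∧_; _∨_; if_then_else_)
import Data.Bool.Properties as Bool
open import Data.Bool.Properties using (∧-conicalˡ; ∧-conicalʳ; ∨-zeroʳ)
open import Data.Bool.ListAction using (and)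
open import Data.Nat using (ℕ; zero; suc; >-nonZero; _+_; _*_; _≤_; _<_; z≤n; s≤s; _⊔_; _⊓_)
open import Data.Nat.Properties
  using (≤-refl; ≤-trans; ≤-reflexive; ≤-antisym; +-mono-≤; *-mono-≤; *-monoʳ-≤; m≤m+n; m≤n+m;
         +-assoc; +-comm; +-identityʳ; *-zeroʳ; *-distribˡ-+; *-distribʳ-+; *-cancelˡ-≤;
         *-commutativeSemigroup; ⊔-sel; m≤m⊔n; m≤n⊔m; m⊓n≤m; m⊓n≤n; module ≤-Reasoning)
open import Algebra.Properties.CommutativeSemigroup *-commutativeSemigroup using (x∙yz≈y∙xz)
open import Data.Nat.ListAction using (sum)
open import Data.Nat.ListAction.Properties using (sum-++; sum-↭)
open import Data.Fin using (Fin; zero; suc; _≟_; remQuot; combine)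
open import Data.Fin.Properties using (any?; all?; remQuot-combine; combine-remQuot; combine-injective)
open import Data.Fin.Subset using (Subset; ∣_∣; ⊥)
open import Data.Fin.Subset.Properties using (∣⊥∣≡0)
open import Data.Vec using (Vec; []; _∷_; lookup; tabulate)
import Data.Vec.Properties as Vec
open import Data.Vec.Properties using (lookup-replicate; lookup∘tabulate; tabulate-cong; tabulate∘lookup)
open import Data.List
  using (List; []; _∷_; _++_; map; foldr; length; allFin; filter; cartesianProduct; cartesianProductWith)
open import Data.List.Properties using (map-++; map-∘; map-tabulate; length-tabulate)
open import Data.List.Membership.Propositional using (_∈_)
open import Data.List.Membership.Propositional.Properties
  using (∈-allFin; ∈-length; ∈-map⁺; ∈-map⁻; ∈-++⁺ˡ; ∈-++⁺ʳ; ∈-filter⁺; ∈-filter⁻;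
         ∈-cartesianProduct⁺; ∈-cartesianProductWith⁺; foldr-selective)
open import Data.List.Membership.Propositional.Properties.WithK using (unique∧set⇒bag)
open import Data.List.Relation.Binary.BagAndSetEquality using (∼bag⇒↭)
open import Data.List.Relation.Binary.Permutation.Propositional.Properties using (map⁺)
open import Data.List.Relation.Unary.Any using (here; there)
open import Data.List.Relation.Unary.All as All using (All; []; _∷_)
open import Data.List.Relation.Unary.AllPairs using ([]; _∷_)
open import Data.List.Relation.Unary.Unique.Propositional using (Unique)
import Data.List.Relation.Unary.Unique.Propositional.Properties as Unique
open import Data.List.Relation.Unary.Unique.Propositional.Properties using (allFin⁺; cartesianProduct⁺)
open import Relation.Binary.Definitions using (DecidableEquality)
open import Relation.Binary.PropositionalEquality
  using (_≡_; _≢_; refl; sym; trans; cong; cong₂; subst; subst₂; module ≡-Reasoning)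
import Relation.Unary as U
open import Relation.Nullary using (¬_; Dec; does; yes; no; contradiction)
open import Relation.Nullary.Decidable using (dec-true; dec-false; _×-dec_)

private variable
  a b : Level
  A : Set a
  B : Set b

∑ : List A → (A → ℕ) → ℕ
∑ xs f = sum (map f xs)

∑-cong : (xs : List A) {f g : A → ℕ} → (∀ {x} → x ∈ xs → f x ≡ g x) → ∑ xs f ≡ ∑ xs g
∑-cong []       f≡g = refl
∑-cong (x ∷ xs) f≡g = cong₂ _+_ (f≡g (here refl)) (∑-cong xs (f≡g ∘ there))

∑-mono-≤ : (xs : List A) {f g : A → ℕ} → (∀ {x} → x ∈ xs → f x ≤ g x) → ∑ xs f ≤ ∑ xs g
∑-mono-≤ []       f≤g = z≤n
∑-mono-≤ (x ∷ xs) f≤g = +-mono-≤ (f≤g (here refl)) (∑-mono-≤ xs (f≤g ∘ there))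

∑-distrib-+ : (xs : List A) (f g : A → ℕ) → ∑ xs (λ x → f x + g x) ≡ ∑ xs f + ∑ xs g
∑-distrib-+ []       f g = refl
∑-distrib-+ (x ∷ xs) f g = begin
  (f x + g x) + ∑ xs (λ x → f x + g x) ≡⟨ cong ((f x + g x) +_) (∑-distrib-+ xs f g) ⟩
  (f x + g x) + (∑ xs f + ∑ xs g)      ≡⟨ +-assoc (f x) (g x) _ ⟩
  f x + (g x + (∑ xs f + ∑ xs g))      ≡⟨ cong (f x +_) (sym (+-assoc (g x) _ _)) ⟩
  f x + ((g x + ∑ xs f) + ∑ xs g)      ≡⟨ cong (λ t → f x + (t + ∑ xs g)) (+-comm (g x) _) ⟩
  f x + ((∑ xs f + g x) + ∑ xs g)      ≡⟨ cong (f x +_) (+-assoc (∑ xs f) (g x) _) ⟩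
  f x + (∑ xs f + (g x + ∑ xs g))      ≡⟨ sym (+-assoc (f x) _ _) ⟩
  (f x + ∑ xs f) + (g x + ∑ xs g)      ∎
  where open ≡-Reasoning

*-distribˡ-∑ : (c : ℕ) (xs : List A) (f : A → ℕ) → c * ∑ xs f ≡ ∑ xs (λ x → c * f x)
*-distribˡ-∑ c []       f = *-zeroʳ c
*-distribˡ-∑ c (x ∷ xs) f = trans (*-distribˡ-+ c (f x) _) (cong (c * f x +_) (*-distribˡ-∑ c xs f))

*-distribʳ-∑ : (c : ℕ) (xs : List A) (f : A → ℕ) → ∑ xs f * c ≡ ∑ xs (λ x → f x * c)
*-distribʳ-∑ c []       f = refl
*-distribʳ-∑ c (x ∷ xs) f = trans (*-distribʳ-+ c (f x) _) (cong (f x * c +_) (*-distribʳ-∑ c xs f))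

∑-const : (xs : List A) (c : ℕ) → ∑ xs (λ _ → c) ≡ length xs * c
∑-const []       c = refl
∑-const (x ∷ xs) c = cong (c +_) (∑-const xs c)

∑-comm : (xs : List A) (ys : List B) (f : A → B → ℕ) →
         ∑ xs (λ x → ∑ ys (f x)) ≡ ∑ ys (λ y → ∑ xs (λ x → f x y))
∑-comm []       ys f = sym (trans (∑-const ys 0) (*-zeroʳ (length ys)))
∑-comm (x ∷ xs) ys f = begin
  ∑ ys (f x) + ∑ xs (λ x → ∑ ys (f x))        ≡⟨ cong (∑ ys (f x) +_) (∑-comm xs ys f) ⟩
  ∑ ys (f x) + ∑ ys (λ y → ∑ xs (λ x → f x y)) ≡⟨ sym (∑-distrib-+ ys (f x) _) ⟩
  ∑ ys (λ y → f x y + ∑ xs (λ x → f x y))      ∎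
  where open ≡-Reasoning

∑-map : (r : A → B) (xs : List A) (f : B → ℕ) → ∑ (map r xs) f ≡ ∑ xs (f ∘ r)
∑-map r xs f = cong sum (sym (map-∘ xs))

∑-cartesianProduct : (xs : List A) (ys : List B) (f : A × B → ℕ) →
                     ∑ (cartesianProduct xs ys) f ≡ ∑ xs (λ x → ∑ ys (λ y → f (x , y)))
∑-cartesianProduct []       ys f = refl
∑-cartesianProduct (x ∷ xs) ys f = begin
  sum (map f (map (x ,_) ys ++ cartesianProduct xs ys))     ≡⟨ cong sum (map-++ f (map (x ,_) ys) _) ⟩
  sum (map f (map (x ,_) ys) ++ map f (cartesianProduct xs ys)) ≡⟨ sum-++ (map f (map (x ,_) ys)) _ ⟩
  ∑ (map (x ,_) ys) f + ∑ (cartesianProduct xs ys) f          ≡⟨ cong₂ _+_ (∑-map (x ,_) ys f) (∑-cartesianProduct xs ys f) ⟩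
  ∑ ys (λ y → f (x , y)) + ∑ xs (λ x → ∑ ys (λ y → f (x , y))) ∎
  where open ≡-Reasoning

∈⇒≤∑ : {xs : List A} (f : A → ℕ) {x : A} → x ∈ xs → f x ≤ ∑ xs f
∈⇒≤∑ f (here refl)          = m≤m+n (f _) _
∈⇒≤∑ {xs = y ∷ _} f (there x∈) = ≤-trans (∈⇒≤∑ f x∈) (m≤n+m _ (f y))

∑-positive : (xs : List A) (f : A → ℕ) → 0 < ∑ xs f → ∃[ x ] (x ∈ xs × 0 < f x)
∑-positive (x ∷ xs) f 0<∑ with f x in fx≡
... | suc _ = x , here refl , subst (0 <_) (sym fx≡) (s≤s z≤n)
... | zero  with x′ , x′∈ , 0<fx′ ← ∑-positive xs f 0<∑ = x′ , there x′∈ , 0<fx′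

∑-vanishing : (xs : List A) (f : A → ℕ) → All (λ x → f x ≡ 0) xs → ∑ xs f ≡ 0
∑-vanishing []       f []            = refl
∑-vanishing (x ∷ xs) f (fx≡0 ∷ rest) = cong₂ _+_ fx≡0 (∑-vanishing xs f rest)

∑-≤1 : {xs : List A} (f : A → ℕ) → Unique xs → (∀ x → f x ≤ 1) →
       (∀ {x y} → 0 < f x → 0 < f y → x ≡ y) → ∑ xs f ≤ 1
∑-≤1 {xs = []}     f []          f≤1 supp = z≤n
∑-≤1 {xs = x ∷ xs} f (x∉ ∷ uniq) f≤1 supp with f x in fx≡
... | zero          = ∑-≤1 f uniq f≤1 supp
... | suc zero      = ≤-reflexive (cong suc (∑-vanishing xs f (All.map vanishes x∉)))
  where
  vanishes : ∀ {y} → x ≢ y → f y ≡ 0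
  vanishes {y} x≢y with f y in fy≡
  ... | zero  = refl
  ... | suc _ = ⊥-elim (x≢y (supp (subst (0 <_) (sym fx≡) (s≤s z≤n)) (subst (0 <_) (sym fy≡) (s≤s z≤n))))
... | suc (suc _) with s≤s () ← subst (_≤ 1) fx≡ (f≤1 x)

∑-↭ : {xs ys : List A} (f : A → ℕ) → Unique xs → Unique ys →
      (∀ {z} → z ∈ xs → z ∈ ys) → (∀ {z} → z ∈ ys → z ∈ xs) → ∑ xs f ≡ ∑ ys f
∑-↭ f uxs uys xs⊆ys ys⊆xs = sum-↭ (map⁺ f (∼bag⇒↭ (unique∧set⇒bag uxs uys (mk⇔ xs⊆ys ys⊆xs))))

⟦_⟧ : Bool → ℕ
⟦ true  ⟧ = 1
⟦ false ⟧ = 0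

⟦⟧≤1 : ∀ b → ⟦ b ⟧ ≤ 1
⟦⟧≤1 true  = ≤-refl
⟦⟧≤1 false = z≤n

⟦∧⟧ : ∀ b c → ⟦ b ∧ c ⟧ ≡ ⟦ b ⟧ * ⟦ c ⟧
⟦∧⟧ true  c = sym (+-identityʳ ⟦ c ⟧)
⟦∧⟧ false c = refl

⟦⟧-positive : ∀ {b} → 0 < ⟦ b ⟧ → b ≡ true
⟦⟧-positive {true} _ = refl

≤1⇒≤⟦⟧ : ∀ {t b} → t ≤ 1 → (0 < t → b ≡ true) → t ≤ ⟦ b ⟧
≤1⇒≤⟦⟧ {zero}        _       _    = z≤n
≤1⇒≤⟦⟧ {suc zero}    _       0<t⇒ rewrite 0<t⇒ (s≤s z≤n) = ≤-refl
≤1⇒≤⟦⟧ {suc (suc _)} (s≤s ()) _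

∧-middle-false : ∀ a b c → not a ∧ b ∧ c ≡ false → a ≡ false → c ≡ true → b ≡ false
∧-middle-false false false _    _ refl _    = refl
∧-middle-false false true  true () refl refl

∧-false-intro : ∀ a b c → (b ≡ true → c ≡ true → Empty) → a ∧ b ∧ c ≡ false
∧-false-intro false _     _     _     = refl
∧-false-intro true  false _     _     = refl
∧-false-intro true  true  false _     = refl
∧-false-intro true  true  true  b∧c⇒ = ⊥-elim (b∧c⇒ refl refl)

does-true⇒ : ∀ {p} {P : Set p} (P? : Dec P) → does P? ≡ true → P
does-true⇒ (yes p) _ = p

∑-indicator : (_≟_ : DecidableEquality A) {xs : List A} {x : A} → Unique xs → x ∈ xs →
              ∑ xs (λ y → ⟦ does (x ≟ y) ⟧) ≡ 1
∑-indicator _≟_ {xs} {x} uniq x∈ = ≤-antisym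
  (∑-≤1 _ uniq (λ y → ⟦⟧≤1 (does (x ≟ y)))
        (λ {y} {z} 0<y 0<z → trans (sym (hit 0<y)) (hit 0<z)))
  (subst (_≤ ∑ xs (λ y → ⟦ does (x ≟ y) ⟧)) (cong ⟦_⟧ (dec-true (x ≟ x) refl))
         (∈⇒≤∑ (λ y → ⟦ does (x ≟ y) ⟧) x∈))
  where
  hit : ∀ {y} → 0 < ⟦ does (x ≟ y) ⟧ → x ≡ y
  hit 0<⟦⟧ = does-true⇒ (x ≟ _) (⟦⟧-positive 0<⟦⟧)

-- Double counting over the fibres of f, each of which meets P at most once.
count-≤-image : (_≟_ : DecidableEquality B) {xs : List A} {ys : List B} → Unique xs → Unique ys →
                (P : A → Bool) (Q : B → Bool) (f : A → B) →
                (∀ {x} → P x ≡ true → f x ∈ ys × Q (f x) ≡ true) →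
                (∀ {x x′} → P x ≡ true → P x′ ≡ true → f x ≡ f x′ → x ≡ x′) →
                ∑ xs (λ x → ⟦ P x ⟧) ≤ ∑ ys (λ y → ⟦ Q y ⟧)
count-≤-image _≟_ {xs} {ys} uxs uys P Q f maps-to injective = begin
  ∑ xs (λ x → ⟦ P x ⟧)                                  ≡⟨ ∑-cong xs (sym ∘ spread) ⟩
  ∑ xs (λ x → ∑ ys (λ y → ⟦ P x ⟧ * ⟦ does (f x ≟ y) ⟧)) ≡⟨ ∑-comm xs ys _ ⟩
  ∑ ys (λ y → ∑ xs (λ x → ⟦ P x ⟧ * ⟦ does (f x ≟ y) ⟧)) ≤⟨ ∑-mono-≤ ys (λ _ → fibre≤⟦Q⟧) ⟩
  ∑ ys (λ y → ⟦ Q y ⟧)                                  ∎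
  where
  open ≤-Reasoning
  spread : ∀ {x} → x ∈ xs → ∑ ys (λ y → ⟦ P x ⟧ * ⟦ does (f x ≟ y) ⟧) ≡ ⟦ P x ⟧
  spread {x} _ with P x in Px
  ... | false = trans (∑-const ys 0) (*-zeroʳ (length ys))
  ... | true  = trans (∑-cong ys (λ _ → +-identityʳ _)) (∑-indicator _≟_ uys (proj₁ (maps-to Px)))
  hit : ∀ {x y} → 0 < ⟦ P x ⟧ * ⟦ does (f x ≟ y) ⟧ → P x ≡ true × f x ≡ y
  hit {x} {y} 0< with P x | f x ≟ y
  ... | true | yes fx≡y = refl , fx≡y
  fibre≤⟦Q⟧ : ∀ {y} → ∑ xs (λ x → ⟦ P x ⟧ * ⟦ does (f x ≟ y) ⟧) ≤ ⟦ Q y ⟧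
  fibre≤⟦Q⟧ {y} = ≤1⇒≤⟦⟧ fibre≤1 (λ 0<∑ → let _ , _ , 0<x = ∑-positive xs _ 0<∑ ; Px , fx≡y = hit 0<x
                                          in subst (λ z → Q z ≡ true) fx≡y (proj₂ (maps-to Px)))
    where
    fibre≤1 : ∑ xs (λ x → ⟦ P x ⟧ * ⟦ does (f x ≟ y) ⟧) ≤ 1
    fibre≤1 = ∑-≤1 _ uxs (λ x → *-mono-≤ (⟦⟧≤1 (P x)) (⟦⟧≤1 (does (f x ≟ y))))
                (λ 0<x 0<x′ → let Px , fx≡y = hit 0<x ; Px′ , fx′≡y = hit 0<x′
                              in injective Px Px′ (trans fx≡y (sym fx′≡y)))

∑-allFin-suc : ∀ {n} (f : Fin (suc n) → ℕ) → ∑ (allFin (suc n)) f ≡ f zero + ∑ (allFin n) (f ∘ suc)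
∑-allFin-suc {n} f = cong (f zero +_) (cong sum (trans (map-tabulate suc f) (sym (map-tabulate id (f ∘ suc)))))

∣p∣≡∑⟦∈⟧ : ∀ {n} (s : Subset n) → ∣ s ∣ ≡ ∑ (allFin n) (λ i → ⟦ i ∈? s ⟧)
∣p∣≡∑⟦∈⟧ []          = refl
∣p∣≡∑⟦∈⟧ (true  ∷ s) = trans (cong suc (∣p∣≡∑⟦∈⟧ s)) (sym (∑-allFin-suc (λ i → ⟦ i ∈? (true ∷ s) ⟧)))
∣p∣≡∑⟦∈⟧ (false ∷ s) = trans (∣p∣≡∑⟦∈⟧ s) (sym (∑-allFin-suc (λ i → ⟦ i ∈? (false ∷ s) ⟧)))

∣p∣*c≡∑⟦∈⟧*c : ∀ {n} (s : Subset n) (c : ℕ) → ∣ s ∣ * c ≡ ∑ (allFin n) (λ i → ⟦ i ∈? s ⟧ * c)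
∣p∣*c≡∑⟦∈⟧*c {n} s c = trans (cong (_* c) (∣p∣≡∑⟦∈⟧ s)) (*-distribʳ-∑ c (allFin n) _)

and-map⁻ : (f : A → Bool) {xs : List A} → and (map f xs) ≡ true → ∀ {x} → x ∈ xs → f x ≡ true
and-map⁻ f {y ∷ _} all-true (here refl) = ∧-conicalˡ (f y) _ all-true
and-map⁻ f {y ∷ _} all-true (there x∈)  = and-map⁻ f (∧-conicalʳ (f y) _ all-true) x∈

and-map⁺ : (f : A → Bool) (xs : List A) → (∀ x → f x ≡ true) → and (map f xs) ≡ true
and-map⁺ f []       f≡true = refl
and-map⁺ f (x ∷ xs) f≡true rewrite f≡true x = and-map⁺ f xs f≡true

independent⇒nonadjacent : ∀ {n} (r : Rel n) (s : Subset n) → indep? r s ≡ true →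
  ∀ {i j} → i ≢ j → i ∈? s ≡ true → j ∈? s ≡ true → r i j ≡ false
independent⇒nonadjacent r s s-indep {i} {j} i≢j i∈s j∈s
  with and-map⁻ _ (and-map⁻ _ s-indep (∈-allFin i)) (∈-allFin j)
... | entry rewrite i∈s | j∈s | dec-false (i ≟ j) i≢j with r i j
... | false = refl

nonadjacent⇒independent : ∀ {n} (r : Rel n) (s : Subset n) →
  (∀ {i j} → i ≢ j → i ∈? s ≡ true → j ∈? s ≡ true → r i j ≡ false) → indep? r s ≡ true
nonadjacent⇒independent {n} r s nonadjacent =
  and-map⁺ _ (allFin n) λ i → and-map⁺ _ (allFin n) λ j → entry i j
  where
  entry : ∀ i j → not ((i ∈? s) ∧ (j ∈? s) ∧ not (does (i ≟ j)) ∧ r i j) ≡ true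
  entry i j with i ∈? s in i∈s | j ∈? s in j∈s | i ≟ j
  ... | false | _     | _       = refl
  ... | true  | false | _       = refl
  ... | true  | true  | yes _   = refl
  ... | true  | true  | no i≢j rewrite nonadjacent i≢j i∈s j∈s = refl

∅-independent : ∀ {n} (r : Rel n) → indep? r ⊥ ≡ true
∅-independent r = nonadjacent⇒independent r ⊥ λ {i} _ i∈⊥ _ →
  contradiction (trans (sym (lookup-replicate i false)) i∈⊥) λ ()

allSubsets-complete : ∀ {n} (s : Subset n) → s ∈ allSubsets n
allSubsets-complete []                = here refl
allSubsets-complete {suc n} (true ∷ s)  = ∈-++⁺ˡ (∈-map⁺ (true ∷_) (allSubsets-complete s))
allSubsets-complete {suc n} (false ∷ s) =
  ∈-++⁺ʳ (map (true ∷_) (allSubsets n)) (∈-map⁺ (false ∷_) (allSubsets-complete s))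

∈⇒≤foldr-⊔ : {xs : List ℕ} {x : ℕ} → x ∈ xs → x ≤ foldr _⊔_ 0 xs
∈⇒≤foldr-⊔ (here refl)          = m≤m⊔n _ _
∈⇒≤foldr-⊔ {y ∷ _} (there x∈) = ≤-trans (∈⇒≤foldr-⊔ x∈) (m≤n⊔m y _)

α-maximal : ∀ {n} (r : Rel n) (s : Subset n) → indep? r s ≡ true → ∣ s ∣ ≤ α r
α-maximal r s s-indep = subst (_≤ α r) (cong (λ b → if b then ∣ s ∣ else 0) s-indep)
  (∈⇒≤foldr-⊔ (∈-map⁺ (λ s → if indep? r s then ∣ s ∣ else 0) (allSubsets-complete s)))

α-attained : ∀ {n} (r : Rel n) → ∃[ s ] (indep? r s ≡ true × α r ≡ ∣ s ∣)
α-attained {n} r with foldr-selective ⊔-sel 0 (map size (allSubsets n))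
  where size = λ s → if indep? r s then ∣ s ∣ else 0
... | inj₁ α≡0 = ⊥ , ∅-independent r , trans α≡0 (sym (∣⊥∣≡0 n))
... | inj₂ α∈  with ∈-map⁻ _ α∈
... | s , _ , α≡size with indep? r s in s-indep
...   | true  = s , s-indep , α≡size
...   | false = ⊥ , ∅-independent r , trans α≡size (sym (∣⊥∣≡0 n))

eqOrAdj-refl : ∀ {n} (r : Rel n) (g : Fin n) → eqOrAdj r g g ≡ true
eqOrAdj-refl r g rewrite dec-true (g ≟ g) refl = refl

eqOrAdj-false : ∀ {n} (r : Rel n) {g g′ : Fin n} → eqOrAdj r g g′ ≡ false → g ≢ g′ × r g g′ ≡ false
eqOrAdj-false r {g} {g′} e with g ≟ g′
... | no g≢g′ = g≢g′ , e

eqOrAdj-independent : ∀ {n} (r : Rel n) (s : Subset n) → indep? r s ≡ true →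
  ∀ {g g′} → g ∈? s ≡ true → g′ ∈? s ≡ true → eqOrAdj r g g′ ≡ true → g ≡ g′
eqOrAdj-independent r s s-indep {g} {g′} g∈s g′∈s e with g ≟ g′
... | yes g≡g′ = g≡g′
... | no  g≢g′ = contradiction (trans (sym e) (independent⇒nonadjacent r s s-indep g≢g′ g∈s g′∈s)) λ ()

∈?-union : ∀ {n} (s t : Subset n) i → i ∈? union s t ≡ (i ∈? s ∨ i ∈? t)
∈?-union (_ ∷ s) (_ ∷ t) zero    = refl
∈?-union (_ ∷ s) (_ ∷ t) (suc i) = ∈?-union s t i

disconnected-apart : ∀ {n} (G : Graph n) (s t : Subset n) → disconnected? G s t ≡ true →
  ∀ {g g′} → g ∈? s ≡ true → g′ ∈? t ≡ true → ¬ (eqOrAdj (adj G) g g′ ≡ true)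
disconnected-apart G s t st-disc {g} {g′} g∈s g′∈t e =
  contradiction (and-map⁻ _ (∧-conicalˡ _ _ st-disc) (∈-allFin g)) not-disjoint
  where
  g∈∪ : g ∈? union s t ≡ true
  g∈∪ rewrite ∈?-union s t g | g∈s = refl
  g′∈∪ : g′ ∈? union s t ≡ true
  g′∈∪ rewrite ∈?-union s t g′ | g′∈t = ∨-zeroʳ _
  g∈t : g ∈? t ≡ true
  g∈t = subst (λ x → x ∈? t ≡ true) (sym (eqOrAdj-independent (adj G) (union s t) (∧-conicalʳ _ _ st-disc) g∈∪ g′∈∪ e)) g′∈t
  not-disjoint : not (g ∈? s ∧ g ∈? t) ≢ true
  not-disjoint rewrite g∈s | g∈t = λ ()

π₁ : ∀ k m → Fin (k * m) → Fin k
π₁ k m p = proj₁ (remQuot {k} m p)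

π₂ : ∀ k m → Fin (k * m) → Fin m
π₂ k m p = proj₂ (remQuot {k} m p)

-- I lifts to the independent set image = {(g, w) | g ∈ label h for some (h, w) ∈ I} of G ⊠ W,
-- which the pairs ((h, w), g) with (h, w) ∈ I and g ∈ label h reach injectively.
module Lift {n k m} {G : Graph n} {H : Graph k} (ι : InducedSubOfStar G H) (W : Graph m)
            (I : Subset (k * m)) (I-indep : indep? (adj H ⊠ adj W) I ≡ true) where

  separated : ∀ {p p′} → p ≢ p′ → p ∈? I ≡ true → p′ ∈? I ≡ true →
              eqOrAdj (adj W) (π₂ k m p) (π₂ k m p′) ≡ true →
              disconnected? G (label ι (π₁ k m p)) (label ι (π₁ k m p′)) ≡ true
  separated {p} {p′} p≢p′ p∈I p′∈I w~w′ =
    Bool.not-injective (trans (sym (label-adj ι (π₁ k m p) (π₁ k m p′) h≢h′)) h≁h′)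
    where
    h≄h′ : eqOrAdj (adj H) (π₁ k m p) (π₁ k m p′) ≡ false
    h≄h′ = ∧-middle-false _ _ _ (independent⇒nonadjacent _ I I-indep p≢p′ p∈I p′∈I)
                           (dec-false (p ≟ p′) p≢p′) w~w′
    h≢h′ : π₁ k m p ≢ π₁ k m p′
    h≢h′ = proj₁ (eqOrAdj-false (adj H) h≄h′)
    h≁h′ : adj H (π₁ k m p) (π₁ k m p′) ≡ false
    h≁h′ = proj₂ (eqOrAdj-false (adj H) h≄h′)

  Covers : Fin n → Fin m → Set
  Covers g w = ∃[ p ] (p ∈? I ≡ true × g ∈? label ι (π₁ k m p) ≡ true × π₂ k m p ≡ w)

  covers? : ∀ g w → Dec (Covers g w)
  covers? g w = any? λ p → (p ∈? I Bool.≟ true) ×-dec (g ∈? label ι (π₁ k m p) Bool.≟ true) ×-dec (π₂ k m p ≟ w)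

  image : Subset (n * m)
  image = tabulate λ q → does (covers? (π₁ n m q) (π₂ n m q))

  image⇒covers : ∀ {q} → q ∈? image ≡ true → Covers (π₁ n m q) (π₂ n m q)
  image⇒covers {q} q∈ = does-true⇒ (covers? _ _) (trans (sym (lookup∘tabulate _ q)) q∈)

  covers⇒image : ∀ {g w} → Covers g w → combine g w ∈? image ≡ true
  covers⇒image {g} {w} c = begin
    combine g w ∈? image                                   ≡⟨ lookup∘tabulate _ (combine g w) ⟩
    does (covers? (π₁ n m (combine g w)) (π₂ n m (combine g w))) ≡⟨ cong (λ (g , w) → does (covers? g w)) (remQuot-combine g w) ⟩
    does (covers? g w)                                     ≡⟨ dec-true (covers? g w) c ⟩
    true                                                   ∎
    where open ≡-Reasoning

  image-independent : indep? (adj G ⊠ adj W) image ≡ true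
  image-independent = nonadjacent⇒independent _ image λ {q} {q′} q≢q′ q∈ q′∈ →
    ∧-false-intro (not (does (q ≟ q′))) _ _ (apart q≢q′ (image⇒covers q∈) (image⇒covers q′∈))
    where
    apart : ∀ {q q′} → q ≢ q′ → Covers (π₁ n m q) (π₂ n m q) → Covers (π₁ n m q′) (π₂ n m q′) →
            eqOrAdj (adj G) (π₁ n m q) (π₁ n m q′) ≡ true → eqOrAdj (adj W) (π₂ n m q) (π₂ n m q′) ≡ true → Empty
    apart {q} {q′} q≢q′ (p , p∈I , g∈ , w≡) (p′ , p′∈I , g′∈ , w′≡) g~g′ w~w′ with p ≟ p′
    ... | yes refl = q≢q′ (begin
          q                                ≡⟨ sym (combine-remQuot {n} m q) ⟩
          combine (π₁ n m q) (π₂ n m q)    ≡⟨ cong₂ combine g≡g′ (trans (sym w≡) w′≡) ⟩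
          combine (π₁ n m q′) (π₂ n m q′)  ≡⟨ combine-remQuot {n} m q′ ⟩
          q′                               ∎)
      where
      open ≡-Reasoning
      g≡g′ : π₁ n m q ≡ π₁ n m q′
      g≡g′ = eqOrAdj-independent (adj G) (label ι (π₁ k m p)) (label-indep ι (π₁ k m p)) g∈ g′∈ g~g′
    ... | no p≢p′ = disconnected-apart G (label ι (π₁ k m p)) (label ι (π₁ k m p′)) (separated p≢p′ p∈I p′∈I p~p′) g∈ g′∈ g~g′
      where
      p~p′ : eqOrAdj (adj W) (π₂ k m p) (π₂ k m p′) ≡ true
      p~p′ = subst₂ (λ w w′ → eqOrAdj (adj W) w w′ ≡ true) (sym w≡) (sym w′≡) w~w′

  incident : Fin (k * m) × Fin n → Bool
  incident (p , g) = p ∈? I ∧ g ∈? label ι (π₁ k m p)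

  lift : Fin (k * m) × Fin n → Fin (n * m)
  lift (p , g) = combine g (π₂ k m p)

  lift-injective : ∀ {x x′} → incident x ≡ true → incident x′ ≡ true → lift x ≡ lift x′ → x ≡ x′
  lift-injective {p , g} {p′ , g′} inc inc′ lift≡ with combine-injective g (π₂ k m p) g′ (π₂ k m p′) lift≡ | p ≟ p′
  ... | refl , _     | yes refl = refl
  ... | refl , w≡w′  | no p≢p′  = ⊥-elim
    (disconnected-apart G (label ι (π₁ k m p)) (label ι (π₁ k m p′))
      (separated p≢p′ (∧-conicalˡ _ _ inc) (∧-conicalˡ _ _ inc′)
        (subst (λ w → eqOrAdj (adj W) (π₂ k m p) w ≡ true) w≡w′ (eqOrAdj-refl (adj W) (π₂ k m p))))
      (∧-conicalʳ _ _ inc) (∧-conicalʳ _ _ inc′) (eqOrAdj-refl (adj G) g))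

  lift-image : ∀ {x} → incident x ≡ true → lift x ∈? image ≡ true
  lift-image {p , g} inc = covers⇒image (p , ∧-conicalˡ _ _ inc , ∧-conicalʳ _ _ inc , refl)

  ∑N≤α : ∑ (allFin (k * m)) (λ p → ⟦ p ∈? I ⟧ * N ι (π₁ k m p)) ≤ α (adj G ⊠ adj W)
  ∑N≤α = begin
    ∑ (allFin (k * m)) (λ p → ⟦ p ∈? I ⟧ * N ι (π₁ k m p))       ≡⟨ ∑-cong (allFin (k * m)) (λ {p} _ → weight p) ⟩
    ∑ (allFin (k * m)) (λ p → ∑ (allFin n) (λ g → ⟦ incident (p , g) ⟧)) ≡⟨ sym (∑-cartesianProduct (allFin (k * m)) (allFin n) _) ⟩
    ∑ (cartesianProduct (allFin (k * m)) (allFin n)) (λ x → ⟦ incident x ⟧)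
      ≤⟨ count-≤-image _≟_ (cartesianProduct⁺ (allFin⁺ (k * m)) (allFin⁺ n)) (allFin⁺ (n * m))
                       incident (_∈? image) lift (λ inc → ∈-allFin _ , lift-image inc) lift-injective ⟩
    ∑ (allFin (n * m)) (λ q → ⟦ q ∈? image ⟧)                     ≡⟨ sym (∣p∣≡∑⟦∈⟧ image) ⟩
    ∣ image ∣                                                     ≤⟨ α-maximal _ image image-independent ⟩
    α (adj G ⊠ adj W)                                             ∎
    where
    open ≤-Reasoning
    weight : ∀ p → ⟦ p ∈? I ⟧ * N ι (π₁ k m p) ≡ ∑ (allFin n) (λ g → ⟦ incident (p , g) ⟧)
    weight p = begin-equality
      ⟦ p ∈? I ⟧ * ∣ L ∣                                ≡⟨ cong (⟦ p ∈? I ⟧ *_) (∣p∣≡∑⟦∈⟧ L) ⟩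
      ⟦ p ∈? I ⟧ * ∑ (allFin n) (λ g → ⟦ g ∈? L ⟧)      ≡⟨ *-distribˡ-∑ ⟦ p ∈? I ⟧ (allFin n) _ ⟩
      ∑ (allFin n) (λ g → ⟦ p ∈? I ⟧ * ⟦ g ∈? L ⟧)      ≡⟨ ∑-cong (allFin n) (λ {g} _ → sym (⟦∧⟧ (p ∈? I) (g ∈? L))) ⟩
      ∑ (allFin n) (λ g → ⟦ incident (p , g) ⟧)          ∎
      where L = label ι (π₁ k m p)

minOver≤ : ∀ k (f : Fin k → ℕ) (v : Fin k) → minOver k f ≤ f v
minOver≤ (suc k) f v = foldr-⊓≤ (∈-allFin v)
  where
  foldr-⊓≤ : ∀ {xs} → v ∈ xs → foldr _⊓_ (f zero) (map f xs) ≤ f v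
  foldr-⊓≤ (here refl)          = m⊓n≤m _ _
  foldr-⊓≤ {y ∷ _} (there v∈) = ≤-trans (m⊓n≤n (f y) _) (foldr-⊓≤ v∈)

min-bound : ∀ {n k m} {G : Graph n} {H : Graph k} (ι : InducedSubOfStar G H) (W : Graph m) →
            α (adj H ⊠ adj W) * minOver k (N ι) ≤ α (adj G ⊠ adj W)
min-bound {k = k} {m} {G} {H} ι W with α-attained (adj H ⊠ adj W)
... | I , I-indep , α≡∣I∣ = begin
  α (adj H ⊠ adj W) * μ                                ≡⟨ cong (_* μ) α≡∣I∣ ⟩
  ∣ I ∣ * μ                                            ≡⟨ ∣p∣*c≡∑⟦∈⟧*c I μ ⟩
  ∑ (allFin (k * m)) (λ p → ⟦ p ∈? I ⟧ * μ)            ≤⟨ ∑-mono-≤ (allFin (k * m)) (λ {p} _ →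
                                                            *-monoʳ-≤ ⟦ p ∈? I ⟧ (minOver≤ k (N ι) (π₁ k m p))) ⟩
  ∑ (allFin (k * m)) (λ p → ⟦ p ∈? I ⟧ * N ι (π₁ k m p)) ≤⟨ Lift.∑N≤α ι W I I-indep ⟩
  α (adj G ⊠ adj W)                                    ∎
  where
  open ≤-Reasoning
  μ = minOver k (N ι)

-- An automorphism stored as the pair of tables (f, f⁻¹): there are finitely many tables, so the
-- automorphisms of H can be listed.
Table : ℕ → Set
Table k = Vec (Fin k) k × Vec (Fin k) k

apply : ∀ {k} → Table k → Fin k → Fin k
apply (f , _) = lookup f

IsAutomorphism : ∀ {k} → Graph k → Table k → Set
IsAutomorphism H (f , g) = (∀ i → lookup g (lookup f i) ≡ i) × (∀ i → lookup f (lookup g i) ≡ i) ×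
                           (∀ i j → adj H (lookup f i) (lookup f j) ≡ adj H i j)

isAutomorphism? : ∀ {k} (H : Graph k) → U.Decidable (IsAutomorphism H)
isAutomorphism? H (f , g) = all? (λ i → lookup g (lookup f i) ≟ i) ×-dec all? (λ i → lookup f (lookup g i) ≟ i) ×-dec
                            all? (λ i → all? (λ j → adj H (lookup f i) (lookup f j) Bool.≟ adj H i j))

vectors : ∀ k r → List (Vec (Fin k) r)
vectors k zero    = [] ∷ []
vectors k (suc r) = cartesianProductWith _∷_ (allFin k) (vectors k r)

∈-vectors : ∀ {k r} (v : Vec (Fin k) r) → v ∈ vectors k r
∈-vectors []      = here refl
∈-vectors (i ∷ v) = ∈-cartesianProductWith⁺ _∷_ (∈-allFin i) (∈-vectors v)

vectors-unique : ∀ k r → Unique (vectors k r)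
vectors-unique k zero    = [] ∷ []
vectors-unique k (suc r) =
  Unique.cartesianProductWith⁺ _∷_ (λ eq → Vec.∷-injective eq) (allFin⁺ k) (vectors-unique k r)

automorphisms : ∀ {k} → Graph k → List (Table k)
automorphisms {k} H = filter (isAutomorphism? H) (cartesianProduct (vectors k k) (vectors k k))

∈-automorphisms⁺ : ∀ {k} (H : Graph k) {x} → IsAutomorphism H x → x ∈ automorphisms H
∈-automorphisms⁺ H {f , g} auto = ∈-filter⁺ (isAutomorphism? H) (∈-cartesianProduct⁺ (∈-vectors f) (∈-vectors g)) auto

∈-automorphisms⁻ : ∀ {k} (H : Graph k) {x} → x ∈ automorphisms H → IsAutomorphism H x
∈-automorphisms⁻ {k} H x∈ = proj₂ (∈-filter⁻ (isAutomorphism? H) {xs = cartesianProduct (vectors k k) (vectors k k)} x∈)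

automorphisms-unique : ∀ {k} (H : Graph k) → Unique (automorphisms H)
automorphisms-unique {k} H = Unique.filter⁺ (isAutomorphism? H) (cartesianProduct⁺ (vectors-unique k k) (vectors-unique k k))

identity-automorphism : ∀ {k} (H : Graph k) → IsAutomorphism H (tabulate id , tabulate id)
identity-automorphism H = (λ i → lookup-id (lookup (tabulate id) i) ∙ lookup-id i)
                        , (λ i → lookup-id (lookup (tabulate id) i) ∙ lookup-id i)
                        , (λ i j → cong₂ (adj H) (lookup-id i) (lookup-id j))
  where
  lookup-id = lookup∘tabulate id
  _∙_ = trans

relabel : ∀ {n k} {G : Graph n} {H : Graph k} → InducedSubOfStar G H →
          ∀ x → IsAutomorphism H x → InducedSubOfStar G H
relabel ι (f , g) (g∘f≗id , _ , f-preserves) = record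
  { label       = λ i → label ι (lookup f i)
  ; label-indep = λ i → label-indep ι (lookup f i)
  ; label-inj   = λ i j eq → f-injective (label-inj ι _ _ eq)
  ; label-adj   = λ i j i≢j → trans (sym (f-preserves i j)) (label-adj ι _ _ (i≢j ∘ f-injective))
  }
  where
  f-injective : ∀ {i j} → lookup f i ≡ lookup f j → i ≡ j
  f-injective {i} {j} eq = trans (sym (g∘f≗id i)) (trans (cong (lookup g) eq) (g∘f≗id j))

inverse : ∀ {k} {H : Graph k} → Automorphism H → Automorphism H
inverse {H = H} a = record
  { σ = σ⁻¹ a ; σ⁻¹ = σ a ; left = right a ; right = left a
  ; preserves = λ i j → trans (sym (preserves a (σ⁻¹ a i) (σ⁻¹ a j))) (cong₂ (adj H) (right a i) (right a j))
  }

_⋆_ : ∀ {k} {H : Graph k} → Table k → Automorphism H → Table k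
(f , g) ⋆ a = tabulate (lookup f ∘ σ a) , tabulate (σ⁻¹ a ∘ lookup g)

apply-⋆ : ∀ {k} {H : Graph k} (x : Table k) (a : Automorphism H) i → apply (x ⋆ a) i ≡ apply x (σ a i)
apply-⋆ (f , _) a = lookup∘tabulate (lookup f ∘ σ a)

⋆-automorphism : ∀ {k} {H : Graph k} {x} (a : Automorphism H) → IsAutomorphism H x → IsAutomorphism H (x ⋆ a)
⋆-automorphism {H = H} {f , g} a (g∘f≗id , f∘g≗id , f-preserves) =
  (λ i → begin
    lookup g′ (lookup f′ i)        ≡⟨ cong (lookup g′) (lookup∘tabulate _ i) ⟩
    lookup g′ (lookup f (σ a i))   ≡⟨ lookup∘tabulate _ (lookup f (σ a i)) ⟩
    σ⁻¹ a (lookup g (lookup f (σ a i))) ≡⟨ cong (σ⁻¹ a) (g∘f≗id (σ a i)) ⟩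
    σ⁻¹ a (σ a i)                  ≡⟨ left a i ⟩
    i                              ∎) ,
  (λ i → begin
    lookup f′ (lookup g′ i)        ≡⟨ cong (lookup f′) (lookup∘tabulate _ i) ⟩
    lookup f′ (σ⁻¹ a (lookup g i)) ≡⟨ lookup∘tabulate _ (σ⁻¹ a (lookup g i)) ⟩
    lookup f (σ a (σ⁻¹ a (lookup g i))) ≡⟨ cong (lookup f) (right a (lookup g i)) ⟩
    lookup f (lookup g i)          ≡⟨ f∘g≗id i ⟩
    i                              ∎) ,
  (λ i j → begin
    adj H (lookup f′ i) (lookup f′ j)               ≡⟨ cong₂ (adj H) (lookup∘tabulate _ i) (lookup∘tabulate _ j) ⟩
    adj H (lookup f (σ a i)) (lookup f (σ a j))     ≡⟨ f-preserves (σ a i) (σ a j) ⟩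
    adj H (σ a i) (σ a j)                           ≡⟨ preserves a i j ⟩
    adj H i j                                       ∎)
  where
  open ≡-Reasoning
  f′ = proj₁ ((f , g) ⋆ a)
  g′ = proj₂ ((f , g) ⋆ a)

⋆-inverseʳ : ∀ {k} {H : Graph k} (x : Table k) (a : Automorphism H) → (x ⋆ a) ⋆ inverse a ≡ x
⋆-inverseʳ (f , g) a = cong₂ _,_
  (tabulate≗lookup λ i → trans (lookup∘tabulate _ (σ⁻¹ a i)) (cong (lookup f) (right a i)))
  (tabulate≗lookup λ i → trans (cong (σ a) (lookup∘tabulate _ i)) (right a (lookup g i)))
  where
  tabulate≗lookup : ∀ {k} {h : Fin k → Fin k} {v} → (∀ i → h i ≡ lookup v i) → tabulate h ≡ v
  tabulate≗lookup {v = v} h≗v = trans (tabulate-cong h≗v) (tabulate∘lookup v)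

-- inverse (inverse a) acts as a, so this is ⋆-inverseʳ for inverse a.
⋆-inverseˡ : ∀ {k} {H : Graph k} (x : Table k) (a : Automorphism H) → (x ⋆ inverse a) ⋆ a ≡ x
⋆-inverseˡ x a = ⋆-inverseʳ x (inverse a)

∑-automorphisms-⋆ : ∀ {k} {H : Graph k} (a : Automorphism H) (f : Table k → ℕ) →
                    ∑ (automorphisms H) (λ x → f (x ⋆ a)) ≡ ∑ (automorphisms H) f
∑-automorphisms-⋆ {H = H} a f = trans (sym (∑-map (_⋆ a) (automorphisms H) f))
  (∑-↭ f (Unique.map⁺ ⋆a-injective (automorphisms-unique H)) (automorphisms-unique H) into onto)
  where
  ⋆a-injective : ∀ {x y} → x ⋆ a ≡ y ⋆ a → x ≡ y
  ⋆a-injective {x} {y} eq = trans (sym (⋆-inverseʳ x a)) (trans (cong (_⋆ inverse a) eq) (⋆-inverseʳ y a))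
  into : ∀ {z} → z ∈ map (_⋆ a) (automorphisms H) → z ∈ automorphisms H
  into z∈ with x , x∈ , refl ← ∈-map⁻ (_⋆ a) z∈ =
    ∈-automorphisms⁺ H (⋆-automorphism {x = x} a (∈-automorphisms⁻ H {x} x∈))
  onto : ∀ {z} → z ∈ automorphisms H → z ∈ map (_⋆ a) (automorphisms H)
  onto {z} z∈ = subst (_∈ map (_⋆ a) (automorphisms H)) (⋆-inverseˡ z a)
    (∈-map⁺ (_⋆ a) (∈-automorphisms⁺ H {z ⋆ inverse a} (⋆-automorphism {x = z} (inverse a) (∈-automorphisms⁻ H {z} z∈))))

∑-allFin-automorphism : ∀ {k} {H : Graph k} {x} → IsAutomorphism H x → (f : Fin k → ℕ) →
                        ∑ (allFin k) (f ∘ apply x) ≡ ∑ (allFin k) f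
∑-allFin-automorphism {k} {x = f , g} (g∘f≗id , f∘g≗id , _) h = trans (sym (∑-map (lookup f) (allFin k) h))
  (∑-↭ h (Unique.map⁺ f-injective (allFin⁺ k)) (allFin⁺ k) (λ _ → ∈-allFin _)
         (λ {i} _ → subst (_∈ map (lookup f) (allFin k)) (f∘g≗id i) (∈-map⁺ (lookup f) (∈-allFin (lookup g i)))))
  where
  f-injective : ∀ {i j} → lookup f i ≡ lookup f j → i ≡ j
  f-injective {i} {j} eq = trans (sym (g∘f≗id i)) (trans (cong (lookup g) eq) (g∘f≗id j))

orbitWeight : ∀ {n k} {G : Graph n} {H : Graph k} → InducedSubOfStar G H → Fin k → ℕ
orbitWeight {H = H} ι h = ∑ (automorphisms H) (λ x → N ι (apply x h))

orbitWeight-constant : ∀ {n k} {G : Graph n} {H : Graph k} (ι : InducedSubOfStar G H) →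
                       VertexTransitive H → ∀ h h′ → orbitWeight ι h ≡ orbitWeight ι h′
orbitWeight-constant {H = H} ι transitive h h′ with a , a[h′]≡h ← transitive h′ h = begin
  ∑ (automorphisms H) (λ x → N ι (apply x h))          ≡⟨ ∑-cong (automorphisms H) (λ {x} _ →
                                                            cong (N ι) (trans (cong (apply x) (sym a[h′]≡h)) (sym (apply-⋆ x a h′)))) ⟩
  ∑ (automorphisms H) (λ x → N ι (apply (x ⋆ a) h′))   ≡⟨ ∑-automorphisms-⋆ a (λ x → N ι (apply x h′)) ⟩
  ∑ (automorphisms H) (λ x → N ι (apply x h′))         ∎
  where open ≡-Reasoning

∑-orbitWeight : ∀ {n k} {G : Graph n} {H : Graph k} (ι : InducedSubOfStar G H) →
                ∑ (allFin k) (orbitWeight ι) ≡ length (automorphisms H) * sumOver k (N ι)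
∑-orbitWeight {k = k} {H = H} ι = begin
  ∑ (allFin k) (orbitWeight ι)                                   ≡⟨ ∑-comm (allFin k) (automorphisms H) _ ⟩
  ∑ (automorphisms H) (λ x → ∑ (allFin k) (λ h → N ι (apply x h))) ≡⟨ ∑-cong (automorphisms H) (λ {x} x∈ →
                                                                      ∑-allFin-automorphism {H = H} {x} (∈-automorphisms⁻ H {x} x∈) (N ι)) ⟩
  ∑ (automorphisms H) (λ _ → sumOver k (N ι))                    ≡⟨ ∑-const (automorphisms H) _ ⟩
  length (automorphisms H) * sumOver k (N ι)                     ∎
  where open ≡-Reasoning

orbitWeight-bound : ∀ {n k m} {G : Graph n} {H : Graph k} (ι : InducedSubOfStar G H) (W : Graph m)
                    (I : Subset (k * m)) → indep? (adj H ⊠ adj W) I ≡ true →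
                    ∑ (allFin (k * m)) (λ p → ⟦ p ∈? I ⟧ * orbitWeight ι (π₁ k m p))
                      ≤ length (automorphisms H) * α (adj G ⊠ adj W)
orbitWeight-bound {k = k} {m} {G} {H} ι W I I-indep = begin
  ∑ ps (λ p → ⟦ p ∈? I ⟧ * orbitWeight ι (π₁ k m p))
    ≡⟨ ∑-cong ps (λ {p} _ → *-distribˡ-∑ ⟦ p ∈? I ⟧ (automorphisms H) _) ⟩
  ∑ ps (λ p → ∑ (automorphisms H) (λ x → ⟦ p ∈? I ⟧ * N ι (apply x (π₁ k m p))))
    ≡⟨ ∑-comm ps (automorphisms H) _ ⟩
  ∑ (automorphisms H) (λ x → ∑ ps (λ p → ⟦ p ∈? I ⟧ * N ι (apply x (π₁ k m p))))
    ≤⟨ ∑-mono-≤ (automorphisms H) (λ {x} x∈ → Lift.∑N≤α (relabel ι x (∈-automorphisms⁻ H {x} x∈)) W I I-indep) ⟩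
  ∑ (automorphisms H) (λ _ → α (adj G ⊠ adj W))
    ≡⟨ ∑-const (automorphisms H) _ ⟩
  length (automorphisms H) * α (adj G ⊠ adj W) ∎
  where
  open ≤-Reasoning
  ps = allFin (k * m)

average-cancel : ∀ {a F A k s} ℓ → 0 < ℓ → a * F ≤ ℓ * A → k * F ≡ ℓ * s → a * s ≤ k * A
average-cancel {a} {F} {A} {k} {s} ℓ 0<ℓ aF≤ℓA kF≡ℓs = *-cancelˡ-≤ ℓ {{>-nonZero 0<ℓ}} (begin
  ℓ * (a * s) ≡⟨ x∙yz≈y∙xz ℓ a s ⟩
  a * (ℓ * s) ≡⟨ cong (a *_) (sym kF≡ℓs) ⟩
  a * (k * F) ≡⟨ x∙yz≈y∙xz a k F ⟩
  k * (a * F) ≤⟨ *-monoʳ-≤ k aF≤ℓA ⟩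
  k * (ℓ * A) ≡⟨ x∙yz≈y∙xz k ℓ A ⟩
  ℓ * (k * A) ∎)
  where open ≤-Reasoning

transitive-bound : ∀ {n k m} {G : Graph n} {H : Graph k} (ι : InducedSubOfStar G H) (W : Graph m) →
                   VertexTransitive H → α (adj H ⊠ adj W) * sumOver k (N ι) ≤ k * α (adj G ⊠ adj W)
transitive-bound {k = zero} {G = G} {H} ι W _ = ≤-reflexive (*-zeroʳ (α (adj H ⊠ adj W)))
transitive-bound {k = suc k} {m} {G} {H} ι W transitive with α-attained (adj H ⊠ adj W)
... | I , I-indep , α≡∣I∣ =
  average-cancel {α (adj H ⊠ adj W)} {F} {α (adj G ⊠ adj W)} {suc k} (length (automorphisms H))
                 (∈-length (∈-automorphisms⁺ H {tabulate id , tabulate id} (identity-automorphism H)))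
                 weighted counted
  where
  F = orbitWeight ι zero
  F-constant : ∀ h → F ≡ orbitWeight ι h
  F-constant = orbitWeight-constant ι transitive zero
  weighted : α (adj H ⊠ adj W) * F ≤ length (automorphisms H) * α (adj G ⊠ adj W)
  weighted = begin
    α (adj H ⊠ adj W) * F                                            ≡⟨ cong (_* F) α≡∣I∣ ⟩
    ∣ I ∣ * F                                                        ≡⟨ ∣p∣*c≡∑⟦∈⟧*c I F ⟩
    ∑ (allFin (suc k * m)) (λ p → ⟦ p ∈? I ⟧ * F)                      ≡⟨ ∑-cong (allFin (suc k * m)) (λ {p} _ →
                                                                          cong (⟦ p ∈? I ⟧ *_) (F-constant (π₁ (suc k) m p))) ⟩
    ∑ (allFin (suc k * m)) (λ p → ⟦ p ∈? I ⟧ * orbitWeight ι (π₁ (suc k) m p)) ≤⟨ orbitWeight-bound ι W I I-indep ⟩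
    length (automorphisms H) * α (adj G ⊠ adj W)                     ∎
    where open ≤-Reasoning
  counted : suc k * F ≡ length (automorphisms H) * sumOver (suc k) (N ι)
  counted = begin
    suc k * F                                  ≡⟨ cong (_* F) (sym (length-tabulate {n = suc k} id)) ⟩
    length (allFin (suc k)) * F                ≡⟨ sym (∑-const (allFin (suc k)) F) ⟩
    ∑ (allFin (suc k)) (λ _ → F)               ≡⟨ ∑-cong (allFin (suc k)) (λ {h} _ → F-constant h) ⟩
    ∑ (allFin (suc k)) (orbitWeight ι)         ≡⟨ ∑-orbitWeight ι ⟩
    length (automorphisms H) * sumOver (suc k) (N ι) ∎
    where open ≡-Reasoning

theorem6 : ∀ {n k} (G : Graph n) (H : Graph k) (ι : InducedSubOfStar G H) →
    ((m : ℕ) (W : Graph m) →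
    α (adj H ⊠ adj W) * minOver k (N ι) ≤ α (adj G ⊠ adj W))
    × (VertexTransitive H → (m : ℕ) (W : Graph m) →
    α (adj H ⊠ adj W) * sumOver k (N ι) ≤ k * α (adj G ⊠ adj W))
theorem6 G H ι = (λ m W → min-bound ι W) , (λ transitive m W → transitive-bound ι W transitive)
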